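{- Let $G=(V,E)$ be a connected finite simple graph with $|E|\ge |V|\ge 3$. Then every spanning tree $T$ of $G$ satisfies $noc(G)<noc(T)$.
   Context: For a finite simple undirected graph $G=(V,E)$, a set $S\subseteq V$ is called $P_3$-convex if for every path $x$--$z$--$y$ in $G$ (distinct vertices $x,z,y$ with $xz,zy\in E$) with $x,y\in S$, we also have $z\in S$. The number $noc(G)$ denotes the number of $P_3$-convex subsets of $V$ (including $\emptyset$). -}

module Defs where

open import Data.Nat using (ℕ; _<_; _≤_)
open import Data.Nat.Properties using (_<?_)
open import Data.Bool using (Bool; true; false)
open import Data.Fin using (Fin; toℕ)
open import Data.Fin.Properties using (all?; _≟_)
open import Data.Fin.Subset using (Subset; _∈_)
open import Data.Fin.Subset.Properties using (_∈?_)
open import Data.Vec using (Vec; []; _∷_)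
open import Data.List using (List; []; _∷_; _++_; [_]; length; filter; map; concatMap; allFin)
open import Data.List.Relation.Unary.Linked using (Linked)
open import Data.List.Relation.Unary.Unique.Propositional using (Unique)
open import Data.Product using (Σ; ∃; _×_; _,_)
open import Relation.Nullary using (¬_; Dec; yes; no)
open import Relation.Nullary.Decidable using (_×-dec_; _→-dec_; ¬?)
open import Relation.Binary.PropositionalEquality using (_≡_; _≢_)
open import Data.Bool.Properties using () renaming (_≟_ to _≟ᵇ_)

record Graph (n : ℕ) : Set where
  field
    adj    : Fin n → Fin n → Bool
    sym    : ∀ i j → adj i j ≡ adj j i
    irrefl : ∀ i → adj i i ≡ false
open Graph public

Adj : ∀ {n} → Graph n → Fin n → Fin n → Set
Adj G i j = adj G i j ≡ true

allPairs : (n : ℕ) → List (Fin n × Fin n)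
allPairs n = concatMap (λ i → map (λ j → (i , j)) (allFin n)) (allFin n)

IsEdgePair : ∀ {n} → Graph n → Fin n × Fin n → Set
IsEdgePair G (i , j) = toℕ i < toℕ j × Adj G i j

isEdgePair? : ∀ {n} (G : Graph n) (p : Fin n × Fin n) → Dec (IsEdgePair G p)
isEdgePair? G (i , j) = (toℕ i <? toℕ j) ×-dec (adj G i j ≟ᵇ true)

numEdges : ∀ {n} → Graph n → ℕ
numEdges {n} G = length (filter (isEdgePair? G) (allPairs n))

data Reach {n} (G : Graph n) : Fin n → Fin n → Set where
  here : ∀ {u} → Reach G u u
  step : ∀ {u v w} → Adj G u v → Reach G v w → Reach G u w

Connected : ∀ {n} → Graph n → Set
Connected G = ∀ u v → Reach G u v

HasCycle : ∀ {n} → Graph n → Set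
HasCycle {n} G =
  Σ (Fin n) λ x → Σ (Fin n) λ y → Σ (Fin n) λ z → Σ (List (Fin n)) λ rest →
    Unique (x ∷ y ∷ z ∷ rest) × Linked (Adj G) (x ∷ y ∷ z ∷ rest ++ [ x ])

IsTree : ∀ {n} → Graph n → Set
IsTree G = Connected G × ¬ HasCycle G

IsSpanningTree : ∀ {n} → Graph n → Graph n → Set
IsSpanningTree G T = (∀ i j → Adj T i j → Adj G i j) × IsTree T

P3Convex : ∀ {n} → Graph n → Subset n → Set
P3Convex G S = ∀ x z y → x ≢ y → Adj G x z → Adj G z y → x ∈ S → y ∈ S → z ∈ S

p3Convex? : ∀ {n} (G : Graph n) (S : Subset n) → Dec (P3Convex G S)
p3Convex? G S =
  all? λ x → all? λ z → all? λ y →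
    ¬? (x ≟ y) →-dec ((adj G x z ≟ᵇ true) →-dec ((adj G z y ≟ᵇ true) →-dec
      ((x ∈? S) →-dec ((y ∈? S) →-dec (z ∈? S)))))

allSubsets : (n : ℕ) → List (Subset n)
allSubsets ℕ.zero = [] ∷ []
allSubsets (ℕ.suc n) =
  map (true ∷_) (allSubsets n) ++ map (false ∷_) (allSubsets n)

-- noc(G): number of P3-convex subsets (including ∅)
noc : ∀ {n} → Graph n → ℕ
noc {n} G = length (filter (p3Convex? G) (allSubsets n))

{-# OPTIONS --safe #-}
-- Every P3-convex set of G is P3-convex in its subgraph T, so noc G ≤ noc T, and
-- equality would make the two families of convex sets coincide. Then peel leaves off T:
-- if ℓ has at most one T-neighbour in a T-convex set W, then W - ℓ is again T-convex,
-- hence G-convex, and G-convexity of W - ℓ forces ℓ to have at most one G-neighbour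
-- in W - ℓ. So each removal loses at most one edge of G and a single vertex spans
-- none, giving |E(G)| < |V|.
module Submission where

open import Defs
open import Level using (Level)
open import Data.Nat using (ℕ; zero; suc; _+_; _≤_; _<_; z≤n; s≤s)
open import Data.Nat.Properties
  using (_≤?_; ≰⇒>; ≤-trans; ≤-reflexive; <-irrefl; <-asym; <-≤-trans; ≤-<-trans; ≤∧≢⇒<;
         +-comm; +-suc; +-identityʳ; +-mono-≤; +-monoˡ-≤; +-monoʳ-≤; n≤1+n; module ≤-Reasoning)
open import Data.Nat.Induction using (<-wellFounded)
open import Data.Bool using (true; false)
open import Data.Bool.Properties using () renaming (_≟_ to _≟ᵇ_)
open import Data.Fin using (Fin; fromℕ<)
open import Data.Fin.Properties using (pigeonhole; _≟_; any?; <⇒≢)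
open import Data.Vec using ([]; _∷_; there)
open import Data.Fin.Subset using (Subset; _∈_; _∉_; _-_; ⁅_⁆; ⊤; ∣_∣; Nonempty; Empty)
open import Data.Fin.Subset.Properties
  using (_∈?_; nonempty?; ∈⊤; ∣⊤∣≡n; p─q⊆p; x∈p∧x≢y⇒x∈p-y; x∈p⇒∣p-x∣<∣p∣)
open import Data.List
  using (List; []; _∷_; _++_; [_]; length; lookup; take; filter; map; concatMap; allFin; cartesianProduct)
open import Data.List.Properties using (filter-none)
open import Data.List.Membership.Propositional using () renaming (_∈_ to _∈ˡ_)
open import Data.List.Membership.Propositional.Properties
  using (∈-lookup; ∈-filter⁺; ∈-filter⁻; ∈-++⁺ˡ; ∈-++⁺ʳ; ∈-map⁺)
open import Data.List.Relation.Unary.Any using (here; there)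
open import Data.List.Relation.Unary.All using (All; []; _∷_)
import Data.List.Relation.Unary.All as All
open import Data.List.Relation.Unary.All.Properties using (all-filter; ¬Any⇒All¬)
open import Data.List.Relation.Unary.AllPairs using ([]; _∷_)
open import Data.List.Relation.Unary.Linked using (Linked; [-]; _∷_)
import Data.List.Relation.Unary.Linked as Linked
open import Data.List.Relation.Unary.Unique.Propositional using (Unique)
import Data.List.Relation.Unary.Unique.Propositional.Properties as Unique
open import Data.List.Relation.Binary.Sublist.Heterogeneous using (Sublist)
open import Data.List.Relation.Binary.Sublist.Heterogeneous.Properties
  using (⊆-filter-Sublist; length-mono-≤; toPointwise; fromPointwise)
open import Data.List.Relation.Binary.Pointwise using (Pointwise-≡⇒≡; ≡⇒Pointwise-≡)
open import Data.Product using (∃; ∃₂; _×_; _,_; proj₁; proj₂)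
open import Data.Sum using (_⊎_; inj₁; inj₂; [_,_]′)
open import Data.Empty using (⊥; ⊥-elim)
open import Function using (_on_; _$_)
open import Induction.WellFounded using (Acc; acc)
open import Relation.Binary.Construct.On using (wellFounded)
open import Relation.Unary using (Pred; Decidable; _⊆_; _∪_)
open import Relation.Nullary using (¬_; Dec; yes; no)
open import Relation.Nullary.Decidable using (_×-dec_; _⊎-dec_; ¬?; decidable-stable)
open import Relation.Binary.PropositionalEquality as ≡ using (_≡_; _≢_; refl; trans; cong; subst)

private variable
  a p q r : Level
  A B : Set a

module _ {P : Pred A p} {Q : Pred A q} (P? : Decidable P) (Q? : Decidable Q) where

  filter-Sublist-mono : P ⊆ Q → ∀ xs → Sublist _≡_ (filter P? xs) (filter Q? xs)
  filter-Sublist-mono P⊆Q xs =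
    ⊆-filter-Sublist P? Q? {as = xs} (λ { refl → P⊆Q }) (fromPointwise (≡⇒Pointwise-≡ refl))

  count-mono : P ⊆ Q → ∀ xs → length (filter P? xs) ≤ length (filter Q? xs)
  count-mono P⊆Q xs = length-mono-≤ (filter-Sublist-mono P⊆Q xs)

  count-≡⇒⊇ : P ⊆ Q → ∀ {xs} → length (filter P? xs) ≡ length (filter Q? xs) →
              ∀ {x} → x ∈ˡ xs → Q x → P x
  count-≡⇒⊇ P⊆Q {xs} counts≡ {x} x∈xs qx =
    proj₂ (∈-filter⁻ P? {xs = xs} (subst (x ∈ˡ_) (≡.sym filters≡) (∈-filter⁺ Q? x∈xs qx)))
    where
    filters≡ : filter P? xs ≡ filter Q? xs
    filters≡ = Pointwise-≡⇒≡ (toPointwise counts≡ (filter-Sublist-mono P⊆Q xs))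

module _ {P : Pred A p} {Q : Pred A q} {R : Pred A r}
         (P? : Decidable P) (Q? : Decidable Q) (R? : Decidable R) where

  count-⊆-∪ : P ⊆ Q ∪ R → ∀ xs →
              length (filter P? xs) ≤ length (filter Q? xs) + length (filter R? xs)
  count-⊆-∪ P⊆Q∪R [] = z≤n
  count-⊆-∪ P⊆Q∪R (x ∷ xs) with ih ← count-⊆-∪ P⊆Q∪R xs | P? x | Q? x | R? x
  ... | yes _  | yes _ | yes _ = s≤s (≤-trans ih (+-monoʳ-≤ (length (filter Q? xs)) (n≤1+n _)))
  ... | yes _  | yes _ | no _  = s≤s ih
  ... | yes _  | no _  | yes _ = ≤-trans (s≤s ih) (≤-reflexive (≡.sym (+-suc _ _)))
  ... | yes px | no ¬q | no ¬r = ⊥-elim ([ ¬q , ¬r ]′ (P⊆Q∪R px))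
  ... | no _   | yes _ | yes _ = ≤-trans ih (+-mono-≤ (n≤1+n _) (n≤1+n _))
  ... | no _   | yes _ | no _  = ≤-trans ih (+-monoˡ-≤ (length (filter R? xs)) (n≤1+n _))
  ... | no _   | no _  | yes _ = ≤-trans ih (+-monoʳ-≤ (length (filter Q? xs)) (n≤1+n _))
  ... | no _   | no _  | no _  = ih

module _ {P : Pred A p} (P? : Decidable P) where

  count-subsingleton : (∀ {x y} → P x → P y → x ≡ y) → ∀ {xs} → Unique xs → length (filter P? xs) ≤ 1
  count-subsingleton P-unique {xs} u = unique⇒length≤1 (Unique.filter⁺ P? u) (all-filter P? xs)
    where
    unique⇒length≤1 : ∀ {ys} → Unique ys → All P ys → length ys ≤ 1
    unique⇒length≤1 [] _ = z≤n
    unique⇒length≤1 (_ ∷ []) _ = s≤s z≤n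
    unique⇒length≤1 ((y≢z ∷ _) ∷ _) (py ∷ pz ∷ _) = ⊥-elim (y≢z (P-unique py pz))

lookup-injective : ∀ {xs : List A} → Unique xs → ∀ i j → lookup xs i ≡ lookup xs j → i ≡ j
lookup-injective {xs = _ ∷ _} _ Fin.zero Fin.zero _ = refl
lookup-injective {xs = _ ∷ _} (x∉ ∷ _) Fin.zero (Fin.suc j) eq = ⊥-elim (All.lookup x∉ (∈-lookup j) eq)
lookup-injective {xs = _ ∷ _} (x∉ ∷ _) (Fin.suc i) Fin.zero eq = ⊥-elim (All.lookup x∉ (∈-lookup i) (≡.sym eq))
lookup-injective {xs = _ ∷ _} (_ ∷ u) (Fin.suc i) (Fin.suc j) eq = cong Fin.suc (lookup-injective u i j eq)

Unique⇒length≤ : ∀ {n} {xs : List (Fin n)} → Unique xs → length xs ≤ n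
Unique⇒length≤ {n} {xs} u with length xs ≤? n
... | yes len≤n = len≤n
... | no len≰n with pigeonhole (≰⇒> len≰n) (lookup xs)
...   | i , j , i<j , eq = ⊥-elim (<⇒≢ i<j (lookup-injective u i j eq))

module _ {R : A → A → Set r} where

  Linked-shortcut : ∀ {b c w xs} → w ∈ˡ xs → Linked R (b ∷ xs) → R w c →
                    ∃ λ k → ∃₂ λ z zs → take k xs ≡ z ∷ zs × Linked R (b ∷ z ∷ zs ++ [ c ])
  Linked-shortcut {xs = x ∷ _} (here refl) bxs wc = 1 , x , [] , refl , Linked.head bxs ∷ wc ∷ [-]
  Linked-shortcut {xs = x ∷ _} (there w∈xs) bxs wc with Linked-shortcut w∈xs (Linked.tail bxs) wc
  ... | k , z , zs , take≡ , bzs = suc k , x , z ∷ zs , cong (x ∷_) take≡ , Linked.head bxs ∷ bzs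

concatMap-pairs≡cartesianProduct : ∀ (xs : List A) (ys : List B) →
                                   concatMap (λ x → map (x ,_) ys) xs ≡ cartesianProduct xs ys
concatMap-pairs≡cartesianProduct [] ys = refl
concatMap-pairs≡cartesianProduct (x ∷ xs) ys = cong (map (x ,_) ys ++_) (concatMap-pairs≡cartesianProduct xs ys)

allPairs-unique : ∀ n → Unique (allPairs n)
allPairs-unique n = subst Unique (≡.sym (concatMap-pairs≡cartesianProduct (allFin n) (allFin n)))
                          (Unique.cartesianProduct⁺ (Unique.allFin⁺ n) (Unique.allFin⁺ n))

∈-allSubsets : ∀ {n} (S : Subset n) → S ∈ˡ allSubsets n
∈-allSubsets [] = here refl
∈-allSubsets (true ∷ S) = ∈-++⁺ˡ (∈-map⁺ (true ∷_) (∈-allSubsets S))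
∈-allSubsets {suc n} (false ∷ S) =
  ∈-++⁺ʳ (map (true ∷_) (allSubsets n)) (∈-map⁺ (false ∷_) (∈-allSubsets S))

x∉p-x : ∀ {n} {x : Fin n} {p : Subset n} → x ∉ p - x
x∉p-x {x = Fin.zero} {_ ∷ _} ()
x∉p-x {x = Fin.suc _} {_ ∷ _} (there x∈p-x) = x∉p-x x∈p-x

x∈p-y⇒x∈p : ∀ {n} {x y : Fin n} {p : Subset n} → x ∈ p - y → x ∈ p
x∈p-y⇒x∈p {y = y} {p} = p─q⊆p p ⁅ y ⁆

module _ {n : ℕ} (G : Graph n) where

  Adj-sym : ∀ {i j} → Adj G i j → Adj G j i
  Adj-sym {i} {j} aij = trans (≡.sym (sym G i j)) aij

  Adj⇒≢ : ∀ {i j} → Adj G i j → i ≢ j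
  Adj⇒≢ {i} aii refl with trans (≡.sym aii) (irrefl G i)
  ... | ()

  AtMostOneNeighbour : Subset n → Fin n → Set
  AtMostOneNeighbour W ℓ = ∀ {x y} → x ∈ W → y ∈ W → Adj G ℓ x → Adj G ℓ y → x ≡ y

  Branching : Subset n → Fin n → Set
  Branching W ℓ = ∃₂ λ x y → x ∈ W × y ∈ W × Adj G ℓ x × Adj G ℓ y × x ≢ y

  branching? : ∀ W ℓ → Dec (Branching W ℓ)
  branching? W ℓ = any? λ x → any? λ y →
    x ∈? W ×-dec y ∈? W ×-dec adj G ℓ x ≟ᵇ true ×-dec adj G ℓ y ≟ᵇ true ×-dec ¬? (x ≟ y)

  ¬Branching⇒AtMostOneNeighbour : ∀ {W ℓ} → ¬ Branching W ℓ → AtMostOneNeighbour W ℓ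
  ¬Branching⇒AtMostOneNeighbour ¬branching {x} {y} x∈W y∈W ℓx ℓy =
    decidable-stable (x ≟ y) λ x≢y → ¬branching (x , y , x∈W , y∈W , ℓx , ℓy , x≢y)

  cycle-closing : ∀ {a b w rest} → Unique (a ∷ b ∷ rest) → Linked (Adj G) (a ∷ b ∷ rest) →
                  w ∈ˡ rest → Adj G w a → HasCycle G
  cycle-closing {a} {b} u path w∈rest wa with Linked-shortcut w∈rest (Linked.tail path) wa
  ... | k , z , zs , take≡ , bzs =
    a , b , z , zs , subst (λ ys → Unique (a ∷ b ∷ ys)) take≡ (Unique.take⁺ (2 + k) u) ,
    Linked.head path ∷ bzs

  module _ {W : Subset n} (branching : ∀ {ℓ} → ℓ ∈ W → Branching W ℓ) where
    open import Data.List.Membership.DecPropositional (_≟_ {n}) using () renaming (_∈?_ to _∈ˡ?_)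

    next-vertex : ∀ {a} → a ∈ W → ∀ b → ∃ λ w → w ∈ W × Adj G a w × w ≢ b
    next-vertex a∈W b with branching a∈W
    ... | x , y , x∈W , y∈W , ax , ay , x≢y with x ≟ b
    ...   | yes refl = y , y∈W , ay , λ y≡x → x≢y (≡.sym y≡x)
    ...   | no x≢b   = x , x∈W , ax , x≢b

    -- The path is kept newest-first; `fuel` only bounds the recursion, since a
    -- path without repetitions has at most n vertices.
    extend-path : ∀ fuel {a b rest} → n < length (a ∷ b ∷ rest) + fuel →
                  Unique (a ∷ b ∷ rest) → Linked (Adj G) (a ∷ b ∷ rest) → a ∈ W → HasCycle G
    extend-path zero lt u _ _ =
      ⊥-elim (<-irrefl refl (<-≤-trans lt (subst (_≤ n) (≡.sym (+-identityʳ _)) (Unique⇒length≤ u))))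
    extend-path (suc fuel) {a} {b} {rest} lt u path a∈W with next-vertex a∈W b
    ... | w , w∈W , aw , w≢b with w ∈ˡ? (a ∷ b ∷ rest)
    ...   | yes (here refl)            = ⊥-elim (Adj⇒≢ aw refl)
    ...   | yes (there (here w≡b))     = ⊥-elim (w≢b w≡b)
    ...   | yes (there (there w∈rest)) = cycle-closing u path w∈rest (Adj-sym aw)
    ...   | no w∉path =
      extend-path fuel (subst (n <_) (+-suc _ fuel) lt) (¬Any⇒All¬ _ w∉path ∷ u) (Adj-sym aw ∷ path) w∈W

    allBranching⇒HasCycle : Nonempty W → HasCycle G
    allBranching⇒HasCycle (u , u∈W) with next-vertex u∈W u
    ... | x , x∈W , ux , _ =
      extend-path n (s≤s (n≤1+n n)) ((Adj⇒≢ (Adj-sym ux) ∷ []) ∷ [] ∷ []) (Adj-sym ux ∷ [-]) x∈W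

  acyclic⇒leaf : ¬ HasCycle G → ∀ {W} → Nonempty W → ∃ λ ℓ → ℓ ∈ W × AtMostOneNeighbour W ℓ
  acyclic⇒leaf acyclic {W} nonempty with any? (λ ℓ → ℓ ∈? W ×-dec ¬? (branching? W ℓ))
  ... | yes (ℓ , ℓ∈W , ¬branching) = ℓ , ℓ∈W , ¬Branching⇒AtMostOneNeighbour ¬branching
  ... | no noLeaf = ⊥-elim (acyclic (allBranching⇒HasCycle allBranching nonempty))
    where
    allBranching : ∀ {ℓ} → ℓ ∈ W → Branching W ℓ
    allBranching {ℓ} ℓ∈W = decidable-stable (branching? W ℓ) λ ¬branching → noLeaf (ℓ , ℓ∈W , ¬branching)

  P3Convex-remove-leaf : ∀ {W ℓ} → AtMostOneNeighbour W ℓ → P3Convex G W → P3Convex G (W - ℓ)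
  P3Convex-remove-leaf {W} {ℓ} leaf convex x z y x≢y xz zy x∈ y∈ = x∈p∧x≢y⇒x∈p-y z∈W z≢ℓ
    where
    x∈W : x ∈ W
    x∈W = x∈p-y⇒x∈p x∈
    y∈W : y ∈ W
    y∈W = x∈p-y⇒x∈p y∈
    z∈W : z ∈ W
    z∈W = convex x z y x≢y xz zy x∈W y∈W
    z≢ℓ : z ≢ ℓ
    z≢ℓ refl = x≢y (leaf x∈W y∈W (Adj-sym xz) zy)

  P3Convex-remove⇒AtMostOneNeighbour : ∀ {W ℓ} → P3Convex G (W - ℓ) → AtMostOneNeighbour (W - ℓ) ℓ
  P3Convex-remove⇒AtMostOneNeighbour {ℓ = ℓ} convex {x} {y} x∈ y∈ ℓx ℓy =
    decidable-stable (x ≟ y) λ x≢y → x∉p-x (convex x ℓ y x≢y (Adj-sym ℓx) ℓy x∈ y∈)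

_⊆ᴱ_ : ∀ {n} → Graph n → Graph n → Set
H ⊆ᴱ G = ∀ i j → Adj H i j → Adj G i j

module _ {n : ℕ} (H G : Graph n) (H⊆G : H ⊆ᴱ G) where

  P3Convex-antitone : ∀ {S} → P3Convex G S → P3Convex H S
  P3Convex-antitone convex x z y x≢y xz zy = convex x z y x≢y (H⊆G x z xz) (H⊆G z y zy)

  noc-antitone : noc G ≤ noc H
  noc-antitone = count-mono (p3Convex? G) (p3Convex? H) P3Convex-antitone (allSubsets n)

  noc-≡⇒P3Convex-⊆ : noc G ≡ noc H → ∀ {S} → P3Convex H S → P3Convex G S
  noc-≡⇒P3Convex-⊆ noc≡ {S} =
    count-≡⇒⊇ (p3Convex? G) (p3Convex? H) P3Convex-antitone noc≡ (∈-allSubsets S)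

module _ {n : ℕ} (G : Graph n) where

  EdgeWithin : Subset n → Fin n × Fin n → Set
  EdgeWithin W (i , j) = IsEdgePair G (i , j) × i ∈ W × j ∈ W

  edgeWithin? : ∀ W → Decidable (EdgeWithin W)
  edgeWithin? W (i , j) = isEdgePair? G (i , j) ×-dec i ∈? W ×-dec j ∈? W

  edgesWithin : Subset n → ℕ
  edgesWithin W = length (filter (edgeWithin? W) (allPairs n))

  numEdges≤edgesWithin⊤ : numEdges G ≤ edgesWithin ⊤
  numEdges≤edgesWithin⊤ = count-mono (isEdgePair? G) (edgeWithin? ⊤) (λ e → e , ∈⊤ , ∈⊤) (allPairs n)

  edgesWithin≡0 : ∀ {W ℓ} → Empty (W - ℓ) → edgesWithin W ≡ 0
  edgesWithin≡0 {W} {ℓ} empty = cong length (filter-none (edgeWithin? W) (All.universal noEdge (allPairs n)))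
    where
    noEdge : ∀ e → ¬ EdgeWithin W e
    noEdge (i , j) ((i<j , _) , i∈W , j∈W) with i ≟ ℓ
    ... | no i≢ℓ  = empty (i , x∈p∧x≢y⇒x∈p-y i∈W i≢ℓ)
    ... | yes refl = empty (j , x∈p∧x≢y⇒x∈p-y j∈W (λ j≡i → <⇒≢ i<j (≡.sym j≡i)))

  module _ {W : Subset n} {ℓ : Fin n} where

    IncidentEdge : Fin n × Fin n → Set
    IncidentEdge (i , j) = EdgeWithin W (i , j) × (i ≡ ℓ ⊎ j ≡ ℓ)

    incidentEdge? : Decidable IncidentEdge
    incidentEdge? (i , j) = edgeWithin? W (i , j) ×-dec (i ≟ ℓ ⊎-dec j ≟ ℓ)

    EdgeWithin-split : EdgeWithin W ⊆ EdgeWithin (W - ℓ) ∪ IncidentEdge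
    EdgeWithin-split {i , j} (ij , i∈W , j∈W) with i ≟ ℓ | j ≟ ℓ
    ... | yes i≡ℓ | _       = inj₂ ((ij , i∈W , j∈W) , inj₁ i≡ℓ)
    ... | no _    | yes j≡ℓ = inj₂ ((ij , i∈W , j∈W) , inj₂ j≡ℓ)
    ... | no i≢ℓ  | no j≢ℓ  = inj₁ (ij , x∈p∧x≢y⇒x∈p-y i∈W i≢ℓ , x∈p∧x≢y⇒x∈p-y j∈W j≢ℓ)

    upper-neighbour : ∀ {j} → EdgeWithin W (ℓ , j) → j ∈ W - ℓ
    upper-neighbour ((ℓ<j , _) , _ , j∈W) = x∈p∧x≢y⇒x∈p-y j∈W (λ j≡ℓ → <⇒≢ ℓ<j (≡.sym j≡ℓ))

    lower-neighbour : ∀ {i} → EdgeWithin W (i , ℓ) → i ∈ W - ℓ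
    lower-neighbour ((i<ℓ , _) , i∈W , _) = x∈p∧x≢y⇒x∈p-y i∈W (<⇒≢ i<ℓ)

    IncidentEdge-unique : AtMostOneNeighbour G (W - ℓ) ℓ →
                          ∀ {e f} → IncidentEdge e → IncidentEdge f → e ≡ f
    IncidentEdge-unique leaf (e , inj₁ refl) (f , inj₁ refl) =
      cong (ℓ ,_) (leaf (upper-neighbour e) (upper-neighbour f) (proj₂ (proj₁ e)) (proj₂ (proj₁ f)))
    IncidentEdge-unique leaf (e , inj₂ refl) (f , inj₂ refl) =
      cong (_, ℓ) (leaf (lower-neighbour e) (lower-neighbour f)
                        (Adj-sym G (proj₂ (proj₁ e))) (Adj-sym G (proj₂ (proj₁ f))))
    IncidentEdge-unique leaf (e , inj₁ refl) (f , inj₂ refl) = ⊥-elim (above-and-below e f)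
      where
      above-and-below : ∀ {i j} → EdgeWithin W (ℓ , j) → EdgeWithin W (i , ℓ) → ⊥
      above-and-below e@((ℓ<j , ℓj) , _) f@((i<ℓ , iℓ) , _)
        with refl ← leaf (upper-neighbour e) (lower-neighbour f) ℓj (Adj-sym G iℓ) = <-asym ℓ<j i<ℓ
    IncidentEdge-unique leaf (e , inj₂ refl) (f , inj₁ refl) =
      ≡.sym (IncidentEdge-unique leaf (f , inj₁ refl) (e , inj₂ refl))

    edgesWithin-remove : AtMostOneNeighbour G (W - ℓ) ℓ → edgesWithin W ≤ suc (edgesWithin (W - ℓ))
    edgesWithin-remove leaf = begin
      edgesWithin W
        ≤⟨ count-⊆-∪ (edgeWithin? W) (edgeWithin? (W - ℓ)) incidentEdge? EdgeWithin-split (allPairs n) ⟩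
      edgesWithin (W - ℓ) + length (filter incidentEdge? (allPairs n))
        ≤⟨ +-monoʳ-≤ (edgesWithin (W - ℓ))
                     (count-subsingleton incidentEdge? (IncidentEdge-unique leaf) (allPairs-unique n)) ⟩
      edgesWithin (W - ℓ) + 1
        ≡⟨ +-comm (edgesWithin (W - ℓ)) 1 ⟩
      suc (edgesWithin (W - ℓ))
        ∎
      where open ≤-Reasoning

edgesWithin<∣∣ : ∀ {n} (G T : Graph n) → (∀ {S} → P3Convex T S → P3Convex G S) → ¬ HasCycle T →
                 ∀ {W} → P3Convex T W → Nonempty W → edgesWithin G W < ∣ W ∣
edgesWithin<∣∣ G T T-convex⇒G-convex acyclic {W} = peel W (wellFounded ∣_∣ <-wellFounded W)
  where
  peel : ∀ W → Acc (_<_ on ∣_∣) W → P3Convex T W → Nonempty W → edgesWithin G W < ∣ W ∣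
  peel W (acc smaller) convex nonempty with acyclic⇒leaf T acyclic nonempty
  ... | ℓ , ℓ∈W , leaf with nonempty? (W - ℓ)
  ...   | no empty =
    subst (_< ∣ W ∣) (≡.sym (edgesWithin≡0 G empty)) (≤-<-trans z≤n (x∈p⇒∣p-x∣<∣p∣ ℓ∈W))
  ...   | yes nonempty-W-ℓ = begin-strict
    edgesWithin G W
      ≤⟨ edgesWithin-remove G (P3Convex-remove⇒AtMostOneNeighbour G (T-convex⇒G-convex convex-W-ℓ)) ⟩
    suc (edgesWithin G (W - ℓ))
      ≤⟨ peel (W - ℓ) (smaller ∣W-ℓ∣<∣W∣) convex-W-ℓ nonempty-W-ℓ ⟩
    ∣ W - ℓ ∣
      <⟨ ∣W-ℓ∣<∣W∣ ⟩
    ∣ W ∣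
      ∎
    where
    open ≤-Reasoning
    ∣W-ℓ∣<∣W∣ : ∣ W - ℓ ∣ < ∣ W ∣
    ∣W-ℓ∣<∣W∣ = x∈p⇒∣p-x∣<∣p∣ ℓ∈W
    convex-W-ℓ : P3Convex T (W - ℓ)
    convex-W-ℓ = P3Convex-remove-leaf T leaf convex

corollary2p8 : (n : ℕ) (G : Graph n) → Connected G → n ≤ numEdges G → 3 ≤ n →
    (T : Graph n) → IsSpanningTree G T → noc G < noc T
corollary2p8 n G _ n≤numEdges 3≤n T (T⊆G , _ , acyclic) = ≤∧≢⇒< (noc-antitone T G T⊆G) noc≢
  where
  open ≤-Reasoning
  ⊤-convex : P3Convex T ⊤
  ⊤-convex _ _ _ _ _ _ _ _ = ∈⊤
  ⊤-nonempty : Nonempty (⊤ {n})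
  ⊤-nonempty = fromℕ< (≤-trans (s≤s z≤n) 3≤n) , ∈⊤
  noc≢ : noc G ≢ noc T
  noc≢ noc≡ = <-irrefl refl $ begin-strict
    n
      ≤⟨ n≤numEdges ⟩
    numEdges G
      ≤⟨ numEdges≤edgesWithin⊤ G ⟩
    edgesWithin G ⊤
      <⟨ edgesWithin<∣∣ G T (noc-≡⇒P3Convex-⊆ T G T⊆G noc≡) acyclic ⊤-convex ⊤-nonempty ⟩
    ∣ ⊤ {n} ∣
      ≡⟨ ∣⊤∣≡n n ⟩
    n
      ∎
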